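{- Let $\mathbf{s}=(s_k)_{k\ge 0}$ be a sequence of real or complex numbers and let $m$ be a positive integer. Then $D_{ -m,n}(\mathbf{s})=0$ for $0<n\le m$, and for every integer $n\ge 0$, $$D_{ -m,n+m+1}(\mathbf{s})=(-1)^{\binom{m+1}{2}}\,D_{m,n}(E\mathbf{s}),$$ where $E\mathbf{s}=(s_{k+1})_{k\ge 0}$ is the shifted sequence.
   Context: For a sequence $\mathbf{s}=(s_k)_{k\ge0}$ define numbers $a_{n,k}(\mathbf{s})$ for $n\ge 0$, $k\in\mathbb{Z}$ by $a_{0,k}(\mathbf{s})=[k=0]$ (i.e. $1$ if $k=0$, else $0$), $a_{n,k}(\mathbf{s})=0$ for $k<0$, and for $n\ge1$, $k\ge 0$: $a_{n,k}(\mathbf{s})=a_{n-1,k-1}(\mathbf{s})+s_k\,a_{n-1,k}(\mathbf{s})+a_{n-1,k+1}(\mathbf{s})$. Extend to all $n\in\mathbb{Z}$ by $a_{n,k}(\mathbf{s})=0$ for $n<0$. Write $a_n(\mathbf{s})=a_{n,0}(\mathbf{s})$. For $m\in\mathbb{Z}$ and $n\ge 0$ define the Hankel determinant $D_{m,n}(\mathbf{s})=\det\left(a_{i+j+m}(\mathbf{s})\right)_{i,j=0}^{n-1}$, with $D_{m,0}(\mathbf{s})=1$. -}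

module Defs where

open import Level using (Level)
open import Algebra.Bundles using (CommutativeRing)
open import Data.Nat using (ℕ; zero; suc)
open import Data.Integer using (ℤ; +_; -[1+_]) renaming (_+_ to _+ℤ_)
open import Data.Fin using (Fin; zero; suc; toℕ; punchIn)

module _ {c ℓ : Level} (R : CommutativeRing c ℓ) where
  open CommutativeRing R hiding (zero)

  negOnePow : ℕ → Carrier
  negOnePow zero = 1#
  negOnePow (suc e) = (- 1#) * negOnePow e

  sumFin : (n : ℕ) → (Fin n → Carrier) → Carrier
  sumFin zero f = 0#
  sumFin (suc n) f = f zero + sumFin n (λ i → f (suc i))

  det : (n : ℕ) → (Fin n → Fin n → Carrier) → Carrier
  det zero M = 1#
  det (suc n) M =
    sumFin (suc n) (λ j → negOnePow (toℕ j) * (M zero j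
      * det n (λ i k → M (suc i) (punchIn j k))))

  -- a_{n,k}(s) for n, k ≥ 0 (a_{n,-1} = 0 is built into the k = 0 case)
  aNK : (ℕ → Carrier) → ℕ → ℕ → Carrier
  aNK s zero zero = 1#
  aNK s zero (suc k) = 0#
  aNK s (suc n) zero = s zero * aNK s n zero + aNK s n (suc zero)
  aNK s (suc n) (suc k) =
    aNK s n k + s (suc k) * aNK s n (suc k) + aNK s n (suc (suc k))

  aZ : (ℕ → Carrier) → ℤ → Carrier
  aZ s (+ n) = aNK s n zero
  aZ s -[1+ n ] = 0#

  hankelD : (ℕ → Carrier) → ℤ → ℕ → Carrier
  hankelD s m n = det n (λ i j → aZ s ((+ toℕ i +ℤ + toℕ j) +ℤ m))

{-# OPTIONS --safe #-}
-- Let A(z) = Σ aₙ zⁿ and let B(z) be the same series for the shifted sequence Es.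
-- Splitting a path at its last visit to height 0 gives A = 1 + s₀zA + z²AB, so the
-- coefficients a⁻¹ of 1 − s₀z − z²B form the convolution inverse of a. Multiplying the
-- Hankel matrix (a_{i+j−m}) (with a_{<0} = 0) on the left by the unitriangular Toeplitz
-- matrix of a⁻¹ does not change its determinant and turns its first m + 1 columns into the
-- unit vectors e_m, …, e_0. Removing them costs the sign (−1)^C(m+1,2) of reversing m + 1
-- indices, and what is left is the Toeplitz matrix of a times the Hankel matrix
-- (b_{i+j+m}), whose determinant is D_{m,n}(Es). For 0 < n ≤ m the first row (a_{j−m})
-- of the Hankel matrix is zero.
module Submission where

open import Defs
open import Algebra.Bundles using (CommutativeRing)
open import Data.Nat using (ℕ; suc; _+_; _≤_; _<_)
open import Data.Nat.Combinatorics using (_C_)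
open import Data.Integer using (+_) renaming (-_ to -ℤ_)
open import Data.Product using (_×_)

open import Level using (Level)
open import Data.Nat using (zero; _∸_; _≡ᵇ_; z≤n; s≤s; _≟_; _<?_)
import Data.Nat.Properties as ℕ
open import Data.Nat.Combinatorics using (nC1≡n; nCk+nC[k+1]≡[n+1]C[k+1])
open import Data.Fin using (Fin; zero; suc; toℕ; punchIn)
open import Data.Fin.Properties using (toℕ<n; toℕ-inject₁; toℕ-fromℕ)
open import Data.Product using (_,_)
open import Data.Bool using (if_then_else_)
open import Data.Empty using (⊥-elim)
open import Function using (_∘_)
open import Relation.Nullary using (yes; no)
import Relation.Binary.PropositionalEquality as ≡
open ≡ using (_≡_; _≢_)
import Data.Integer as ℤ
open import Data.Integer.Properties using ([1+m]⊖[1+n]≡m⊖n)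
open import Data.Nat.Tactic.RingSolver using (solve-∀)

module HankelDeterminants {c ℓ : Level} (R : CommutativeRing c ℓ) where
  open CommutativeRing R hiding (zero) renaming (_+_ to _⊕_; _*_ to _⊗_)
  open import Algebra.Properties.Ring ring using (-1*x≈-x; -‿+-comm; -‿distribˡ-*; \\-leftDividesˡ; x∙y⁻¹≈ε⇒x≈y)
  open import Algebra.Properties.Semiring.Sum semiring
    using (sum; sum-cong-≋; sum-cong-≗; sum-replicate-zero; sum-init-last; ∑-distrib-+; ∑-comm; *-distribˡ-sum)
  open import Algebra.Solver.Ring.NaturalCoefficients.Default commutativeSemiring
    using (solve; _:=_; _:+_; _:*_; con)
  open import Relation.Binary.Reasoning.Setoid setoid

  sgn : ℕ → Carrier
  sgn = negOnePow R

  sgn-+ : ∀ p q → sgn (p + q) ≈ sgn p ⊗ sgn q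
  sgn-+ zero q = sym (*-identityˡ _)
  sgn-+ (suc p) q = trans (*-congˡ (sgn-+ p q)) (sym (*-assoc _ _ _))

  δ : ℕ → ℕ → Carrier
  δ i j = if i ≡ᵇ j then 1# else 0#

  δ-refl : ∀ i → δ i i ≈ 1#
  δ-refl zero = refl
  δ-refl (suc i) = δ-refl i

  δ-≢ : ∀ i j → i ≢ j → δ i j ≈ 0#
  δ-≢ zero zero i≢j = ⊥-elim (i≢j ≡.refl)
  δ-≢ zero (suc j) _ = refl
  δ-≢ (suc i) zero _ = refl
  δ-≢ (suc i) (suc j) i≢j = δ-≢ i j (i≢j ∘ ≡.cong suc)

  δ-+ : ∀ k i j → δ (k + i) (k + j) ≡ δ i j
  δ-+ zero i j = ≡.refl
  δ-+ (suc k) i j = δ-+ k i j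

  ⊗-zero-middle : ∀ σ {x} y → x ≈ 0# → σ ⊗ (x ⊗ y) ≈ 0#
  ⊗-zero-middle σ y x≈0 = trans (*-congˡ (trans (*-congʳ x≈0) (zeroˡ y))) (zeroʳ σ)

  ⊗-zero-inner : ∀ σ x {y} → y ≈ 0# → σ ⊗ (x ⊗ y) ≈ 0#
  ⊗-zero-inner σ x y≈0 = trans (*-congˡ (trans (*-congˡ y≈0) (zeroʳ x))) (zeroʳ σ)

  -- Sums over initial segments of ℕ; opaque so that unification never unfolds a sum into
  -- its vector fold.
  opaque
    sumBelow : ℕ → (ℕ → Carrier) → Carrier
    sumBelow n f = sum {n} (λ i → f (toℕ i))

    sumBelow-suc : ∀ n f → sumBelow (suc n) f ≈ f 0 ⊕ sumBelow n (f ∘ suc)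
    sumBelow-suc n f = refl

    sumBelow-cong : ∀ n {f g : ℕ → Carrier} → (∀ i → i < n → f i ≈ g i) → sumBelow n f ≈ sumBelow n g
    sumBelow-cong n f≈g = sum-cong-≋ (λ i → f≈g (toℕ i) (toℕ<n i))

    sumBelow-zero : ∀ n {f : ℕ → Carrier} → (∀ i → i < n → f i ≈ 0#) → sumBelow n f ≈ 0#
    sumBelow-zero n f≈0 = trans (sumBelow-cong n f≈0) (sum-replicate-zero n)

    sumBelow-init-last : ∀ n (f : ℕ → Carrier) → sumBelow (suc n) f ≈ sumBelow n f ⊕ f n
    sumBelow-init-last n f = trans (sum-init-last {n} (λ i → f (toℕ i)))
      (+-cong (reflexive (sum-cong-≗ {n} (≡.cong f ∘ toℕ-inject₁))) (reflexive (≡.cong f (toℕ-fromℕ n))))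

    sumBelow-+ : ∀ n (f g : ℕ → Carrier) → sumBelow n (λ i → f i ⊕ g i) ≈ sumBelow n f ⊕ sumBelow n g
    sumBelow-+ n f g = ∑-distrib-+ {n} (λ i → f (toℕ i)) (λ i → g (toℕ i))

    sumBelow-*ˡ : ∀ n x (f : ℕ → Carrier) → x ⊗ sumBelow n f ≈ sumBelow n (λ i → x ⊗ f i)
    sumBelow-*ˡ n x f = *-distribˡ-sum {n} x (λ i → f (toℕ i))

    sumBelow-comm : ∀ m n (F : ℕ → ℕ → Carrier) →
      sumBelow m (λ i → sumBelow n (F i)) ≈ sumBelow n (λ j → sumBelow m (λ i → F i j))
    sumBelow-comm m n F = ∑-comm {m} {n} (λ i j → F (toℕ i) (toℕ j))

    sumFin≈sumBelow : ∀ n (f : ℕ → Carrier) → sumFin R n (f ∘ toℕ) ≈ sumBelow n f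
    sumFin≈sumBelow zero f = refl
    sumFin≈sumBelow (suc n) f = +-congˡ (sumFin≈sumBelow n (f ∘ suc))

  sumBelow-single : ∀ n p {f : ℕ → Carrier} → p < n → (∀ i → i < n → i ≢ p → f i ≈ 0#) → sumBelow n f ≈ f p
  sumBelow-single (suc n) zero {f} p<n others = trans (sumBelow-suc n f) (trans
    (+-congˡ (sumBelow-zero n (λ i i<n → others (suc i) (s≤s i<n) λ ())))
    (+-identityʳ _))
  sumBelow-single (suc n) (suc p) {f} (s≤s p<n) others = trans (sumBelow-suc n f) (trans
    (+-cong (others 0 (s≤s z≤n) λ ())
            (sumBelow-single n p p<n (λ i i<n i≢p → others (suc i) (s≤s i<n) (i≢p ∘ ℕ.suc-injective))))
    (+-identityˡ _))

  sumBelow-linear : ∀ n α {f g h : ℕ → Carrier} → (∀ i → f i ≈ α ⊗ g i ⊕ h i) →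
    sumBelow n f ≈ α ⊗ sumBelow n g ⊕ sumBelow n h
  sumBelow-linear n α {f} {g} {h} f≈αg+h = begin
    sumBelow n f                                  ≈⟨ sumBelow-cong n (λ i _ → f≈αg+h i) ⟩
    sumBelow n (λ i → α ⊗ g i ⊕ h i)              ≈⟨ sumBelow-+ n _ h ⟩
    sumBelow n (λ i → α ⊗ g i) ⊕ sumBelow n h     ≈⟨ +-congʳ (sumBelow-*ˡ n α g) ⟨
    α ⊗ sumBelow n g ⊕ sumBelow n h               ∎

  -- Determinants of the leading blocks of ℕ-indexed matrices

  Matrix : Set c
  Matrix = ℕ → ℕ → Carrier

  transpose : Matrix → Matrix
  transpose X i j = X j i

  punchInℕ : ℕ → ℕ → ℕ
  punchInℕ zero k = suc k
  punchInℕ (suc c) zero = zero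
  punchInℕ (suc c) (suc k) = suc (punchInℕ c k)

  toℕ-punchIn : ∀ {n} (j : Fin (suc n)) (k : Fin n) → toℕ (punchIn j k) ≡ punchInℕ (toℕ j) (toℕ k)
  toℕ-punchIn zero k = ≡.refl
  toℕ-punchIn (suc j) zero = ≡.refl
  toℕ-punchIn (suc j) (suc k) = ≡.cong suc (toℕ-punchIn j k)

  punchInℕ-< : ∀ c k → k < c → punchInℕ c k ≡ k
  punchInℕ-< (suc c) zero _ = ≡.refl
  punchInℕ-< (suc c) (suc k) (s≤s k<c) = ≡.cong suc (punchInℕ-< c k k<c)

  punchInℕ-≥ : ∀ c k → c ≤ k → punchInℕ c k ≡ suc k
  punchInℕ-≥ zero k _ = ≡.refl
  punchInℕ-≥ (suc c) (suc k) (s≤s c≤k) = ≡.cong suc (punchInℕ-≥ c k c≤k)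

  minor : ℕ → Matrix → Matrix
  minor c X i k = X (suc i) (punchInℕ c k)

  colMinor : ℕ → Matrix → Matrix
  colMinor r X i k = X (punchInℕ r i) (suc k)

  sumFin-cong : ∀ n {f g : Fin n → Carrier} → (∀ i → f i ≈ g i) → sumFin R n f ≈ sumFin R n g
  sumFin-cong zero f≈g = refl
  sumFin-cong (suc n) f≈g = +-cong (f≈g zero) (sumFin-cong n (f≈g ∘ suc))

  laplaceTerm : ∀ n → (Fin (suc n) → Fin (suc n) → Carrier) → Fin (suc n) → Carrier
  laplaceTerm n M j = negOnePow R (toℕ j) ⊗ (M zero j ⊗ det R n (λ i k → M (suc i) (punchIn j k)))

  det-cong : ∀ n {M N : Fin n → Fin n → Carrier} → (∀ i j → M i j ≈ N i j) → det R n M ≈ det R n N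
  det-cong zero M≈N = refl
  det-cong (suc n) {M} {N} M≈N = sumFin-cong (suc n) {laplaceTerm n M} {laplaceTerm n N} λ j →
    *-congˡ (*-cong (M≈N zero j) (det-cong n (λ i k → M≈N (suc i) (punchIn j k))))

  opaque
    Det : ℕ → Matrix → Carrier
    Det n X = det R n (λ i j → X (toℕ i) (toℕ j))

    Det-cong : ∀ n {X Y : Matrix} → (∀ i j → X i j ≈ Y i j) → Det n X ≈ Det n Y
    Det-cong n X≈Y = det-cong n (λ i j → X≈Y (toℕ i) (toℕ j))

    Det-cong-< : ∀ n {X Y : Matrix} → (∀ i j → i < n → j < n → X i j ≈ Y i j) → Det n X ≈ Det n Y
    Det-cong-< n X≈Y = det-cong n (λ i j → X≈Y (toℕ i) (toℕ j) (toℕ<n i) (toℕ<n j))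

    Det-expand : ∀ n X → Det (suc n) X ≈ sumBelow (suc n) (λ c → sgn c ⊗ (X 0 c ⊗ Det n (minor c X)))
    Det-expand n X = trans
      (sumFin-cong (suc n) {laplaceTerm n (λ i j → X (toℕ i) (toℕ j))} {term ∘ toℕ} λ j → *-congˡ (*-congˡ
        (det-cong n (λ i k → reflexive (≡.cong (X (suc (toℕ i))) (toℕ-punchIn j k))))))
      (sumFin≈sumBelow (suc n) term)
      where
        term : ℕ → Carrier
        term c = sgn c ⊗ (X 0 c ⊗ Det n (minor c X))

    hankelD≡Det : ∀ s m n → hankelD R s m n ≡ Det n (λ i j → aZ R s ((+ i ℤ.+ + j) ℤ.+ m))
    hankelD≡Det s m n = ≡.refl

  Det-zero-row0 : ∀ n X → (∀ j → j < suc n → X 0 j ≈ 0#) → Det (suc n) X ≈ 0#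
  Det-zero-row0 n X row0≈0 = trans (Det-expand n X)
    (sumBelow-zero (suc n) (λ j j<n → ⊗-zero-middle (sgn j) _ (row0≈0 j j<n)))

  Det-unit-row0 : ∀ n c X → c < suc n → (∀ j → X 0 j ≈ δ j c) → Det (suc n) X ≈ sgn c ⊗ Det n (minor c X)
  Det-unit-row0 n c X c<n row0≈e = begin
      Det (suc n) X
    ≈⟨ Det-expand n X ⟩
      sumBelow (suc n) (λ j → sgn j ⊗ (X 0 j ⊗ Det n (minor j X)))
    ≈⟨ sumBelow-single (suc n) c c<n (λ j _ j≢c → ⊗-zero-middle (sgn j) _ (trans (row0≈e j) (δ-≢ j c j≢c))) ⟩
      sgn c ⊗ (X 0 c ⊗ Det n (minor c X))
    ≈⟨ *-congˡ (trans (*-congʳ (trans (row0≈e c) (δ-refl c))) (*-identityˡ _)) ⟩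
      sgn c ⊗ Det n (minor c X)
    ∎

  Det-expand-col : ∀ n X → Det (suc n) X ≈ sumBelow (suc n) (λ r → sgn r ⊗ (X r 0 ⊗ Det n (colMinor r X)))
  Det-expand-col zero X = trans (Det-expand zero X) (sumBelow-cong 1 λ
    { zero _ → *-congˡ (*-congˡ (Det-cong-< 0 λ _ _ ()))
    ; (suc _) (s≤s ()) })
  Det-expand-col (suc n) X = begin
      Det (2 + n) X
    ≈⟨ trans (Det-expand (suc n) X) (sumBelow-suc (suc n) _) ⟩
      t₀ ⊕ sumBelow (suc n) (λ c → sgn (suc c) ⊗ (X 0 (suc c) ⊗ Det (suc n) (minor (suc c) X)))
    ≈⟨ +-congˡ (sumBelow-cong (suc n) λ c _ → *-congˡ (*-congˡ (Det-expand-col n (minor (suc c) X)))) ⟩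
      t₀ ⊕ sumBelow (suc n) (λ c → sgn (suc c) ⊗ (X 0 (suc c) ⊗ sumBelow (suc n) (λ r → sgn r ⊗ (X (suc r) 0 ⊗ M r c))))
    ≈⟨ +-congˡ (sumBelow-cong (suc n) λ c _ → pull (sgn (suc c)) (X 0 (suc c)) _) ⟩
      t₀ ⊕ sumBelow (suc n) (λ c → sumBelow (suc n) (λ r → sgn (suc c) ⊗ (X 0 (suc c) ⊗ (sgn r ⊗ (X (suc r) 0 ⊗ M r c)))))
    ≈⟨ +-congˡ (sumBelow-comm (suc n) (suc n) _) ⟩
      t₀ ⊕ sumBelow (suc n) (λ r → sumBelow (suc n) (λ c → sgn (suc c) ⊗ (X 0 (suc c) ⊗ (sgn r ⊗ (X (suc r) 0 ⊗ M r c)))))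
    ≈⟨ +-congˡ (sumBelow-cong (suc n) λ r _ → sumBelow-cong (suc n) λ c _ → exchange r c) ⟩
      t₀ ⊕ sumBelow (suc n) (λ r → sumBelow (suc n) (λ c → sgn (suc r) ⊗ (X (suc r) 0 ⊗ (sgn c ⊗ (X 0 (suc c) ⊗ M r c)))))
    ≈⟨ +-congˡ (sumBelow-cong (suc n) λ r _ → sym (pull (sgn (suc r)) (X (suc r) 0) _)) ⟩
      t₀ ⊕ sumBelow (suc n) (λ r → sgn (suc r) ⊗ (X (suc r) 0 ⊗ sumBelow (suc n) (λ c → sgn c ⊗ (X 0 (suc c) ⊗ M r c))))
    ≈⟨ +-congˡ (sumBelow-cong (suc n) λ r _ → *-congˡ (*-congˡ (sym (Det-expand n (colMinor (suc r) X))))) ⟩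
      t₀ ⊕ sumBelow (suc n) (λ r → sgn (suc r) ⊗ (X (suc r) 0 ⊗ Det (suc n) (colMinor (suc r) X)))
    ≈⟨ sym (sumBelow-suc (suc n) _) ⟩
      sumBelow (2 + n) (λ r → sgn r ⊗ (X r 0 ⊗ Det (suc n) (colMinor r X)))
    ∎
    where
      t₀ = sgn 0 ⊗ (X 0 0 ⊗ Det (suc n) (minor 0 X))
      M : ℕ → ℕ → Carrier
      M r c = Det n (λ i k → X (suc (punchInℕ r i)) (suc (punchInℕ c k)))
      pull : ∀ σ x f → σ ⊗ (x ⊗ sumBelow (suc n) f) ≈ sumBelow (suc n) (λ i → σ ⊗ (x ⊗ f i))
      pull σ x f = trans (*-congˡ (sumBelow-*ˡ (suc n) x f)) (sumBelow-*ˡ (suc n) σ _)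
      exchange : ∀ r c → sgn (suc c) ⊗ (X 0 (suc c) ⊗ (sgn r ⊗ (X (suc r) 0 ⊗ M r c)))
                       ≈ sgn (suc r) ⊗ (X (suc r) 0 ⊗ (sgn c ⊗ (X 0 (suc c) ⊗ M r c)))
      exchange r c = solve 6 (λ ν σ τ x y d → ((ν :* σ) :* (x :* (τ :* (y :* d)))) := ((ν :* τ) :* (y :* (σ :* (x :* d))))) refl
        (- 1#) (sgn c) (sgn r) (X 0 (suc c)) (X (suc r) 0) (M r c)

  Det-transpose : ∀ n X → Det n (transpose X) ≈ Det n X
  Det-transpose zero X = Det-cong-< 0 λ _ _ ()
  Det-transpose (suc n) X = begin
      Det (suc n) (transpose X)
    ≈⟨ Det-expand n (transpose X) ⟩
      sumBelow (suc n) (λ c → sgn c ⊗ (X c 0 ⊗ Det n (minor c (transpose X))))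
    ≈⟨ sumBelow-cong (suc n) (λ c _ → *-congˡ (*-congˡ (Det-transpose n (colMinor c X)))) ⟩
      sumBelow (suc n) (λ c → sgn c ⊗ (X c 0 ⊗ Det n (colMinor c X)))
    ≈⟨ sym (Det-expand-col n X) ⟩
      Det (suc n) X
    ∎

  cofactorTerm : ℕ → Matrix → ℕ → Carrier
  cofactorTerm n X c = sgn c ⊗ (X 0 c ⊗ Det n (minor c X))

  Det-linear-by-terms : ∀ n α {X Y Z : Matrix} → (∀ c → cofactorTerm n Z c ≈ α ⊗ cofactorTerm n X c ⊕ cofactorTerm n Y c) →
    Det (suc n) Z ≈ α ⊗ Det (suc n) X ⊕ Det (suc n) Y
  Det-linear-by-terms n α {X} {Y} {Z} termwise = begin
    Det (suc n) Z                                 ≈⟨ Det-expand n Z ⟩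
    sumBelow (suc n) (cofactorTerm n Z)           ≈⟨ sumBelow-linear (suc n) α termwise ⟩
    α ⊗ sumBelow (suc n) (cofactorTerm n X) ⊕ sumBelow (suc n) (cofactorTerm n Y)
      ≈⟨ +-cong (*-congˡ (Det-expand n X)) (Det-expand n Y) ⟨
    α ⊗ Det (suc n) X ⊕ Det (suc n) Y             ∎

  Det-linear-row : ∀ n r α {X Y Z : Matrix} → r < n →
    (∀ i → i ≢ r → ∀ j → Z i j ≈ X i j) → (∀ i → i ≢ r → ∀ j → Z i j ≈ Y i j) →
    (∀ j → Z r j ≈ α ⊗ X r j ⊕ Y r j) → Det n Z ≈ α ⊗ Det n X ⊕ Det n Y
  Det-linear-row (suc n) zero α {X} {Y} {Z} _ Z≈X Z≈Y Z₀≈ = Det-linear-by-terms n α λ c → begin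
      sgn c ⊗ (Z 0 c ⊗ Det n (minor c Z))
    ≈⟨ *-congˡ (*-congʳ (Z₀≈ c)) ⟩
      sgn c ⊗ ((α ⊗ X 0 c ⊕ Y 0 c) ⊗ Det n (minor c Z))
    ≈⟨ solve 5 (λ σ a x y d → (σ :* ((a :* x :+ y) :* d)) := (a :* (σ :* (x :* d)) :+ σ :* (y :* d))) refl
         (sgn c) α (X 0 c) (Y 0 c) (Det n (minor c Z)) ⟩
      α ⊗ (sgn c ⊗ (X 0 c ⊗ Det n (minor c Z))) ⊕ sgn c ⊗ (Y 0 c ⊗ Det n (minor c Z))
    ≈⟨ +-cong (*-congˡ (*-congˡ (*-congˡ (Det-cong n λ i k → Z≈X (suc i) (λ ()) _))))
              (*-congˡ (*-congˡ (Det-cong n λ i k → Z≈Y (suc i) (λ ()) _))) ⟩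
      α ⊗ cofactorTerm n X c ⊕ cofactorTerm n Y c
    ∎
  Det-linear-row (suc n) (suc r) α {X} {Y} {Z} (s≤s r<n) Z≈X Z≈Y Zᵣ≈ = Det-linear-by-terms n α λ c → begin
      sgn c ⊗ (Z 0 c ⊗ Det n (minor c Z))
    ≈⟨ *-congˡ (*-congˡ (Det-linear-row n r α r<n
         (λ i i≢r k → Z≈X (suc i) (i≢r ∘ ℕ.suc-injective) (punchInℕ c k))
         (λ i i≢r k → Z≈Y (suc i) (i≢r ∘ ℕ.suc-injective) (punchInℕ c k))
         (Zᵣ≈ ∘ punchInℕ c))) ⟩
      sgn c ⊗ (Z 0 c ⊗ (α ⊗ Det n (minor c X) ⊕ Det n (minor c Y)))
    ≈⟨ solve 5 (λ σ a z x y → (σ :* (z :* (a :* x :+ y))) := (a :* (σ :* (z :* x)) :+ σ :* (z :* y))) refl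
         (sgn c) α (Z 0 c) (Det n (minor c X)) (Det n (minor c Y)) ⟩
      α ⊗ (sgn c ⊗ (Z 0 c ⊗ Det n (minor c X))) ⊕ sgn c ⊗ (Z 0 c ⊗ Det n (minor c Y))
    ≈⟨ +-cong (*-congˡ (*-congˡ (*-congʳ (Z≈X 0 (λ ()) c)))) (*-congˡ (*-congʳ (Z≈Y 0 (λ ()) c))) ⟩
      α ⊗ cofactorTerm n X c ⊕ cofactorTerm n Y c
    ∎

  Det-rows01-cancel : ∀ n X → (∀ j → X 0 j ≈ X 1 j) →
    Det (2 + n) X ≈ sumBelow n (λ r → sgn (2 + r) ⊗ (X (2 + r) 0 ⊗ Det (suc n) (colMinor (2 + r) X)))
  Det-rows01-cancel n X X₀≈X₁ = begin
      Det (2 + n) X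
    ≈⟨ Det-expand-col (suc n) X ⟩
      sumBelow (2 + n) (λ r → sgn r ⊗ (X r 0 ⊗ Det (suc n) (colMinor r X)))
    ≈⟨ trans (sumBelow-suc (suc n) _) (+-congˡ (sumBelow-suc n _)) ⟩
      1# ⊗ (X 0 0 ⊗ Det (suc n) (colMinor 0 X)) ⊕ ((- 1# ⊗ 1#) ⊗ u ⊕ rest)
    ≈⟨ +-cong (trans (*-identityˡ _) (*-cong (X₀≈X₁ 0) (Det-cong (suc n) same-minor)))
              (+-congʳ (trans (*-congʳ (*-identityʳ _)) (-1*x≈-x u))) ⟩
      u ⊕ (- u ⊕ rest)
    ≈⟨ \\-leftDividesˡ u rest ⟩
      rest
    ∎
    where
      u = X 1 0 ⊗ Det (suc n) (colMinor 1 X)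
      rest = sumBelow n (λ r → sgn (2 + r) ⊗ (X (2 + r) 0 ⊗ Det (suc n) (colMinor (2 + r) X)))
      same-minor : ∀ i k → colMinor 0 X i k ≈ colMinor 1 X i k
      same-minor zero k = sym (X₀≈X₁ (suc k))
      same-minor (suc i) k = refl

  Det-equal-rows01 : ∀ n X → (∀ j → X 0 j ≈ X 1 j) → Det (2 + n) X ≈ 0#
  Det-equal-rows01 zero X X₀≈X₁ = trans (Det-rows01-cancel zero X X₀≈X₁) (sumBelow-zero 0 λ _ ())
  Det-equal-rows01 (suc n) X X₀≈X₁ = trans (Det-rows01-cancel (suc n) X X₀≈X₁) (sumBelow-zero (suc n) λ r _ →
    ⊗-zero-inner (sgn (2 + r)) _ (Det-equal-rows01 n (colMinor (2 + r) X) (X₀≈X₁ ∘ suc)))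

  Det-equal-adjacent-rows : ∀ n r X → suc r < n → (∀ j → X r j ≈ X (suc r) j) → Det n X ≈ 0#
  Det-equal-adjacent-rows (suc (suc n)) zero X _ Xᵣ≈Xᵣ₊₁ = Det-equal-rows01 n X Xᵣ≈Xᵣ₊₁
  Det-equal-adjacent-rows (suc n) (suc r) X (s≤s r+1<n) Xᵣ≈Xᵣ₊₁ = trans (Det-expand n X) (sumBelow-zero (suc n) λ c _ →
    ⊗-zero-inner (sgn c) _ (Det-equal-adjacent-rows n r (minor c X) r+1<n (Xᵣ≈Xᵣ₊₁ ∘ punchInℕ c)))

  infixl 6 _[_]≔_
  _[_]≔_ : Matrix → ℕ → (ℕ → Carrier) → Matrix
  (X [ p ]≔ u) i with i ≟ p
  ... | yes _ = u
  ... | no _ = X i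

  []≔-hit : ∀ X p u j → (X [ p ]≔ u) p j ≈ u j
  []≔-hit X p u j with p ≟ p
  ... | yes _ = refl
  ... | no p≢p = ⊥-elim (p≢p ≡.refl)

  []≔-miss : ∀ X p u {i} → i ≢ p → ∀ j → (X [ p ]≔ u) i j ≈ X i j
  []≔-miss X p u {i} i≢p j with i ≟ p
  ... | yes i≡p = ⊥-elim (i≢p i≡p)
  ... | no _ = refl

  []≔-unique : ∀ {A X : Matrix} p {u} → (∀ i → i ≢ p → ∀ j → A i j ≈ X i j) → (∀ j → A p j ≈ u j) →
    ∀ i j → A i j ≈ (X [ p ]≔ u) i j
  []≔-unique {A} {X} p {u} off on i j with i ≟ p
  ... | yes ≡.refl = on j
  ... | no i≢p = off i i≢p j

  Det-[]≔-linear : ∀ n p α X (u v : ℕ → Carrier) → p < n →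
    Det n (X [ p ]≔ (λ j → α ⊗ u j ⊕ v j)) ≈ α ⊗ Det n (X [ p ]≔ u) ⊕ Det n (X [ p ]≔ v)
  Det-[]≔-linear n p α X u v p<n = Det-linear-row n p α p<n
    (λ i i≢p j → trans ([]≔-miss X p _ i≢p j) (sym ([]≔-miss X p u i≢p j)))
    (λ i i≢p j → trans ([]≔-miss X p _ i≢p j) (sym ([]≔-miss X p v i≢p j)))
    (λ j → trans ([]≔-hit X p _ j) (sym (+-cong (*-congˡ ([]≔-hit X p u j)) ([]≔-hit X p v j))))

  Det-[]≔-additive : ∀ n p X (u v : ℕ → Carrier) → p < n →
    Det n (X [ p ]≔ (λ j → u j ⊕ v j)) ≈ Det n (X [ p ]≔ u) ⊕ Det n (X [ p ]≔ v)
  Det-[]≔-additive n p X u v p<n = begin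
    Det n (X [ p ]≔ (λ j → u j ⊕ v j))              ≈⟨ Det-cong n ([]≔-unique p (λ i → []≔-miss X p _) λ j →
                                                         trans ([]≔-hit X p _ j) (+-congʳ (sym (*-identityˡ (u j))))) ⟩
    Det n (X [ p ]≔ (λ j → 1# ⊗ u j ⊕ v j))         ≈⟨ Det-[]≔-linear n p 1# X u v p<n ⟩
    1# ⊗ Det n (X [ p ]≔ u) ⊕ Det n (X [ p ]≔ v)    ≈⟨ +-congʳ (*-identityˡ _) ⟩
    Det n (X [ p ]≔ u) ⊕ Det n (X [ p ]≔ v)         ∎

  []≔-comm : ∀ X {p q} u v → p ≢ q → ∀ i j → ((X [ q ]≔ v) [ p ]≔ u) i j ≈ ((X [ p ]≔ u) [ q ]≔ v) i j
  []≔-comm X {p} {q} u v p≢q i j with i ≟ p | i ≟ q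
  ... | yes ≡.refl | yes ≡.refl = ⊥-elim (p≢q ≡.refl)
  ... | yes ≡.refl | no _ = sym ([]≔-hit X p u j)
  ... | no _ | yes ≡.refl = []≔-hit X q v j
  ... | no i≢p | no i≢q = trans ([]≔-miss X q v i≢q j) (sym ([]≔-miss X p u i≢p j))

  -- Induction on the distance: with F u v the determinant after replacing rows p = r + 1
  -- and q by u and v, and x, y the rows r, p of X, we have Det X = F y x, while
  -- F y y = F (x + y) (x + y) = 0 by induction and F x (x + y) = 0 by adjacency.
  Det-equal-rows-at : ∀ d n r q X → q ≡ suc (r + d) → q < n → (∀ j → X r j ≈ X q j) → Det n X ≈ 0#
  Det-equal-rows-at zero n r q X q≡ q<n Xᵣ≈X_q with ≡.trans q≡ (≡.cong suc (ℕ.+-identityʳ r))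
  ... | ≡.refl = Det-equal-adjacent-rows n r X q<n Xᵣ≈X_q
  Det-equal-rows-at (suc d) n r q X q≡ q<n Xᵣ≈X_q = begin
      Det n X                           ≈⟨ Det-cong n restore ⟩
      F y x                             ≈⟨ +-identityʳ (F y x) ⟨
      F y x ⊕ 0#                        ≈⟨ +-congˡ (Det-equal-rows-at d n p q (Y y y) q≡′ q<n (λ j → trans ([]≔-hit _ p y j) (sym (Y-q y y j)))) ⟨
      F y x ⊕ F y y                     ≈⟨ additive-q ⟨
      F y (x ⊞ y)                       ≈⟨ +-identityˡ _ ⟨
      0# ⊕ F y (x ⊞ y)                  ≈⟨ +-congʳ (Det-equal-adjacent-rows n r (Y x (x ⊞ y)) p<n
                                             (λ j → trans (Y-r x (x ⊞ y) j) (sym ([]≔-hit _ p x j)))) ⟨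
      F x (x ⊞ y) ⊕ F y (x ⊞ y)         ≈⟨ Det-[]≔-additive n p (X [ q ]≔ (x ⊞ y)) x y p<n ⟨
      F (x ⊞ y) (x ⊞ y)                 ≈⟨ Det-equal-rows-at d n p q (Y (x ⊞ y) (x ⊞ y)) q≡′ q<n
                                             (λ j → trans ([]≔-hit _ p (x ⊞ y) j) (sym (Y-q (x ⊞ y) (x ⊞ y) j))) ⟩
      0#                                ∎
    where
      p = suc r
      q≡′ : q ≡ suc (p + d)
      q≡′ = ≡.trans q≡ (≡.cong suc (ℕ.+-suc r d))
      p<q : p < q
      p<q = ≡.subst (p <_) (≡.sym q≡′) (s≤s (ℕ.m≤m+n p d))
      p<n : p < n
      p<n = ℕ.<-trans p<q q<n
      q≢p : q ≢ p
      q≢p = ℕ.>⇒≢ p<q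
      r≢p : r ≢ p
      r≢p = ℕ.<⇒≢ (ℕ.n<1+n r)
      r≢q : r ≢ q
      r≢q = ℕ.<⇒≢ (ℕ.<-trans (ℕ.n<1+n r) p<q)
      x y : ℕ → Carrier
      x = X r
      y = X p
      _⊞_ : (ℕ → Carrier) → (ℕ → Carrier) → ℕ → Carrier
      (u ⊞ v) j = u j ⊕ v j
      Y : (ℕ → Carrier) → (ℕ → Carrier) → Matrix
      Y u v = (X [ q ]≔ v) [ p ]≔ u
      F : (ℕ → Carrier) → (ℕ → Carrier) → Carrier
      F u v = Det n (Y u v)
      Y-q : ∀ u v j → Y u v q j ≈ v j
      Y-q u v j = trans ([]≔-miss _ p u q≢p j) ([]≔-hit X q v j)
      Y-r : ∀ u v j → Y u v r j ≈ x j
      Y-r u v j = trans ([]≔-miss _ p u r≢p j) ([]≔-miss X q v r≢q j)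
      restore : ∀ i j → X i j ≈ Y y x i j
      restore = []≔-unique p (λ i _ → []≔-unique q (λ _ _ _ → refl) (λ j → sym (Xᵣ≈X_q j)) i) (λ _ → refl)
      additive-q : F y (x ⊞ y) ≈ F y x ⊕ F y y
      additive-q = begin
        F y (x ⊞ y)                                                 ≈⟨ Det-cong n ([]≔-comm X y (x ⊞ y) (ℕ.<⇒≢ p<q)) ⟩
        Det n ((X [ p ]≔ y) [ q ]≔ (x ⊞ y))                          ≈⟨ Det-[]≔-additive n q (X [ p ]≔ y) x y q<n ⟩
        Det n ((X [ p ]≔ y) [ q ]≔ x) ⊕ Det n ((X [ p ]≔ y) [ q ]≔ y) ≈⟨ +-cong (Det-cong n (λ i j → sym ([]≔-comm X y x (ℕ.<⇒≢ p<q) i j)))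
                                                                                (Det-cong n (λ i j → sym ([]≔-comm X y y (ℕ.<⇒≢ p<q) i j))) ⟩
        F y x ⊕ F y y                                               ∎

  Det-equal-rows : ∀ n {r q} X → r < q → q < n → (∀ j → X r j ≈ X q j) → Det n X ≈ 0#
  Det-equal-rows n {r} {q} X r<q = let d , r+1+d≡q = ℕ.m≤n⇒∃[o]m+o≡n r<q in
    Det-equal-rows-at d n r q X (≡.sym r+1+d≡q)

  []≔-cong : ∀ X p {u v : ℕ → Carrier} → (∀ j → u j ≈ v j) → ∀ i j → (X [ p ]≔ u) i j ≈ (X [ p ]≔ v) i j
  []≔-cong X p {u} u≈v = []≔-unique p (λ _ → []≔-miss X p u) (λ j → trans ([]≔-hit X p u j) (u≈v j))

  Det-add-earlier-rows : ∀ n r t (coeff : ℕ → Carrier) X → t ≤ r → r < n →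
    Det n (X [ r ]≔ (λ j → X r j ⊕ sumBelow t (λ k → coeff k ⊗ X k j))) ≈ Det n X
  Det-add-earlier-rows n r zero coeff X _ _ = Det-cong n λ i j → sym
    ([]≔-unique r (λ _ _ _ → refl) (λ j → sym (trans (+-congˡ (sumBelow-zero 0 λ _ ())) (+-identityʳ _))) i j)
  Det-add-earlier-rows n r (suc t) coeff X t<r r<n = begin
      Det n (X [ r ]≔ (λ j → X r j ⊕ sumBelow (suc t) (term j)))
    ≈⟨ Det-cong n ([]≔-cong X r split-last) ⟩
      Det n (X [ r ]≔ (λ j → coeff t ⊗ X t j ⊕ (X r j ⊕ sumBelow t (term j))))
    ≈⟨ Det-[]≔-linear n r (coeff t) X (X t) _ r<n ⟩
      coeff t ⊗ Det n (X [ r ]≔ X t) ⊕ Det n (X [ r ]≔ (λ j → X r j ⊕ sumBelow t (term j)))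
    ≈⟨ +-cong (trans (*-congˡ repeated-row) (zeroʳ _)) (Det-add-earlier-rows n r t coeff X (ℕ.<⇒≤ t<r) r<n) ⟩
      0# ⊕ Det n X
    ≈⟨ +-identityˡ _ ⟩
      Det n X
    ∎
    where
      term : ℕ → ℕ → Carrier
      term j k = coeff k ⊗ X k j
      split-last : ∀ j → X r j ⊕ sumBelow (suc t) (term j) ≈ coeff t ⊗ X t j ⊕ (X r j ⊕ sumBelow t (term j))
      split-last j = trans (+-congˡ (sumBelow-init-last t (term j)))
        (solve 3 (λ a b c → (a :+ (b :+ c)) := (c :+ (a :+ b))) refl (X r j) (sumBelow t (term j)) (coeff t ⊗ X t j))
      repeated-row : Det n (X [ r ]≔ X t) ≈ 0#
      repeated-row = Det-equal-rows n (X [ r ]≔ X t) t<r r<n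
        (λ j → trans ([]≔-miss X r (X t) (ℕ.<⇒≢ t<r) j) (sym ([]≔-hit X r (X t) j)))

  Det-lower-unitriangular : ∀ n (coeff : ℕ → ℕ → Carrier) {X Z : Matrix} →
    (∀ i j → Z i j ≈ X i j ⊕ sumBelow i (λ k → coeff i k ⊗ X k j)) → Det n Z ≈ Det n X
  Det-lower-unitriangular n coeff {X} {Z} Z≈ = reduce n 0 ≡.refl (λ _ ()) (λ i _ → Z≈ i)
    where
      reduce : ∀ d r → r + d ≡ n → ∀ {W : Matrix} → (∀ i → i < r → ∀ j → W i j ≈ X i j) →
        (∀ i → r ≤ i → ∀ j → W i j ≈ X i j ⊕ sumBelow i (λ k → coeff i k ⊗ X k j)) → Det n W ≈ Det n X
      reduce zero r r+0≡n W≈X _ = Det-cong-< n λ i j i<n _ →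
        W≈X i (≡.subst (i <_) (≡.trans (≡.sym r+0≡n) (ℕ.+-identityʳ r)) i<n) j
      reduce (suc d) r r+d+1≡n {W} W≈X W≈ = begin
          Det n W
        ≈⟨ Det-cong n ([]≔-unique r (λ i r≢i j → sym ([]≔-miss W r (X r) r≢i j)) row-r) ⟩
          Det n (W′ [ r ]≔ (λ j → W′ r j ⊕ sumBelow r (λ k → coeff r k ⊗ W′ k j)))
        ≈⟨ Det-add-earlier-rows n r r (coeff r) W′ ℕ.≤-refl r<n ⟩
          Det n W′
        ≈⟨ reduce d (suc r) (≡.trans (≡.sym (ℕ.+-suc r d)) r+d+1≡n) W′≈X W′≈ ⟩
          Det n X
        ∎
        where
          W′ = W [ r ]≔ X r
          r<n : r < n
          r<n = ≡.subst (r <_) r+d+1≡n (ℕ.m<m+n r (s≤s z≤n))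
          row-r : ∀ j → W r j ≈ W′ r j ⊕ sumBelow r (λ k → coeff r k ⊗ W′ k j)
          row-r j = trans (W≈ r ℕ.≤-refl j) (sym (+-cong ([]≔-hit W r (X r) j) (sumBelow-cong r λ k k<r →
            *-congˡ (trans ([]≔-miss W r (X r) (ℕ.<⇒≢ k<r) j) (W≈X k k<r j)))))
          W′≈X : ∀ i → i < suc r → ∀ j → W′ i j ≈ X i j
          W′≈X i i<r+1 j with i ≟ r
          ... | yes ≡.refl = refl
          ... | no i≢r = W≈X i (ℕ.≤∧≢⇒< (ℕ.≤-pred i<r+1) i≢r) j
          W′≈ : ∀ i → suc r ≤ i → ∀ j → W′ i j ≈ X i j ⊕ sumBelow i (λ k → coeff i k ⊗ X k j)
          W′≈ i r<i j = trans ([]≔-miss W r (X r) (ℕ.>⇒≢ r<i) j) (W≈ i (ℕ.<⇒≤ r<i) j)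

  δ-punchIn : ∀ i j m → δ (i + punchInℕ (suc m) j) m ≈ δ (i + j) m
  δ-punchIn i j m with j <? suc m
  ... | yes j≤m = reflexive (≡.cong (λ k → δ (i + k) m) (punchInℕ-< (suc m) j j≤m))
  ... | no j≰m = trans (δ-≢ _ m (ℕ.>⇒≢ (ℕ.<-trans m<i+j i+j<i+pj))) (sym (δ-≢ _ m (ℕ.>⇒≢ m<i+j)))
    where
      m<i+j : m < i + j
      m<i+j = ℕ.≤-trans (ℕ.≮⇒≥ j≰m) (ℕ.m≤n+m j i)
      i+j<i+pj : i + j < i + punchInℕ (suc m) j
      i+j<i+pj = ≡.subst (i + j <_) (≡.sym (≡.trans (≡.cong (λ k → i + k) (punchInℕ-≥ (suc m) j (ℕ.≮⇒≥ j≰m))) (ℕ.+-suc i j)))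
                   (ℕ.n<1+n (i + j))

  Det-peel-antidiagonal : ∀ m K X → (∀ i j → i ≤ m → X i j ≈ δ (i + j) m) →
    Det (suc m + K) X ≈ sgn (suc m C 2) ⊗ Det K (λ i j → X (suc m + i) (suc m + j))
  Det-peel-antidiagonal zero K X antidiagonal = Det-unit-row0 K 0 X (s≤s z≤n) (λ j → antidiagonal 0 j z≤n)
  Det-peel-antidiagonal (suc m) K X antidiagonal = begin
      Det (suc (suc m + K)) X
    ≈⟨ Det-unit-row0 (suc m + K) (suc m) X (s≤s (ℕ.m≤m+n (suc m) K)) (λ j → antidiagonal 0 j z≤n) ⟩
      sgn (suc m) ⊗ Det (suc m + K) (minor (suc m) X)
    ≈⟨ *-congˡ (Det-peel-antidiagonal m K (minor (suc m) X) λ i j i≤m →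
         trans (antidiagonal (suc i) (punchInℕ (suc m) j) (s≤s i≤m)) (δ-punchIn i j m)) ⟩
      sgn (suc m) ⊗ (sgn (suc m C 2) ⊗ Det K (λ i j → minor (suc m) X (suc m + i) (suc m + j)))
    ≈⟨ *-assoc _ _ _ ⟨
      (sgn (suc m) ⊗ sgn (suc m C 2)) ⊗ Det K (λ i j → minor (suc m) X (suc m + i) (suc m + j))
    ≈⟨ *-cong (sym (sgn-+ (suc m) (suc m C 2))) (Det-cong K λ i j →
         reflexive (≡.cong (X (suc (suc m + i))) (punchInℕ-≥ (suc m) (suc m + j) (ℕ.m≤m+n (suc m) j)))) ⟩
      sgn (suc m + suc m C 2) ⊗ Det K (λ i j → X (suc (suc m) + i) (suc (suc m) + j))
    ≈⟨ *-congʳ (reflexive (≡.cong sgn pascal)) ⟩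
      sgn (suc (suc m) C 2) ⊗ Det K (λ i j → X (suc (suc m) + i) (suc (suc m) + j))
    ∎
    where
      pascal : suc m + suc m C 2 ≡ suc (suc m) C 2
      pascal = ≡.trans (≡.cong (_+ suc m C 2) (≡.sym (nC1≡n (suc m)))) (nCk+nC[k+1]≡[n+1]C[k+1] (suc m) 1)

  -- Convolution of sequences

  infixl 7 _⋆_
  _⋆_ : (ℕ → Carrier) → (ℕ → Carrier) → ℕ → Carrier
  (f ⋆ g) zero = f 0 ⊗ g 0
  (f ⋆ g) (suc T) = ((f ∘ suc) ⋆ g) T ⊕ f 0 ⊗ g (suc T)

  ⋆-cong : ∀ T {f f′ g g′ : ℕ → Carrier} → (∀ x → f x ≈ f′ x) → (∀ x → g x ≈ g′ x) → (f ⋆ g) T ≈ (f′ ⋆ g′) T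
  ⋆-cong zero f≈ g≈ = *-cong (f≈ 0) (g≈ 0)
  ⋆-cong (suc T) f≈ g≈ = +-cong (⋆-cong T (f≈ ∘ suc) g≈) (*-cong (f≈ 0) (g≈ (suc T)))

  ⋆-distribʳ-+ : ∀ T (f f′ g : ℕ → Carrier) → ((λ x → f x ⊕ f′ x) ⋆ g) T ≈ (f ⋆ g) T ⊕ (f′ ⋆ g) T
  ⋆-distribʳ-+ zero f f′ g = distribʳ (g 0) (f 0) (f′ 0)
  ⋆-distribʳ-+ (suc T) f f′ g = begin
      ((λ x → f (suc x) ⊕ f′ (suc x)) ⋆ g) T ⊕ (f 0 ⊕ f′ 0) ⊗ g (suc T)
    ≈⟨ +-congʳ (⋆-distribʳ-+ T (f ∘ suc) (f′ ∘ suc) g) ⟩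
      ((f ∘ suc) ⋆ g) T ⊕ ((f′ ∘ suc) ⋆ g) T ⊕ (f 0 ⊕ f′ 0) ⊗ g (suc T)
    ≈⟨ solve 5 (λ p q u v w → (p :+ q :+ (u :+ v) :* w) := ((p :+ u :* w) :+ (q :+ v :* w))) refl
         (((f ∘ suc) ⋆ g) T) (((f′ ∘ suc) ⋆ g) T) (f 0) (f′ 0) (g (suc T)) ⟩
      (f ⋆ g) (suc T) ⊕ (f′ ⋆ g) (suc T)
    ∎

  ⋆-*ˡ : ∀ T α (f g : ℕ → Carrier) → ((λ x → α ⊗ f x) ⋆ g) T ≈ α ⊗ (f ⋆ g) T
  ⋆-*ˡ zero α f g = *-assoc α (f 0) (g 0)
  ⋆-*ˡ (suc T) α f g = begin
      ((λ x → α ⊗ f (suc x)) ⋆ g) T ⊕ α ⊗ f 0 ⊗ g (suc T)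
    ≈⟨ +-cong (⋆-*ˡ T α (f ∘ suc) g) (*-assoc α (f 0) (g (suc T))) ⟩
      α ⊗ ((f ∘ suc) ⋆ g) T ⊕ α ⊗ (f 0 ⊗ g (suc T))
    ≈⟨ distribˡ α _ _ ⟨
      α ⊗ (f ⋆ g) (suc T)
    ∎

  ⋆-negˡ : ∀ T (f g : ℕ → Carrier) → ((λ x → - f x) ⋆ g) T ≈ - (f ⋆ g) T
  ⋆-negˡ T f g = begin
    ((λ x → - f x) ⋆ g) T           ≈⟨ ⋆-cong T (λ x → sym (-1*x≈-x (f x))) (λ _ → refl) ⟩
    ((λ x → - 1# ⊗ f x) ⋆ g) T      ≈⟨ ⋆-*ˡ T (- 1#) f g ⟩
    - 1# ⊗ (f ⋆ g) T                ≈⟨ -1*x≈-x _ ⟩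
    - (f ⋆ g) T                     ∎

  ⋆-sucʳ : ∀ T (f g : ℕ → Carrier) → (f ⋆ g) (suc T) ≈ f (suc T) ⊗ g 0 ⊕ (f ⋆ (g ∘ suc)) T
  ⋆-sucʳ zero f g = refl
  ⋆-sucʳ (suc T) f g = trans (+-congʳ (⋆-sucʳ T (f ∘ suc) g)) (+-assoc _ _ _)

  ⋆-comm : ∀ T (f g : ℕ → Carrier) → (f ⋆ g) T ≈ (g ⋆ f) T
  ⋆-comm zero f g = *-comm (f 0) (g 0)
  ⋆-comm (suc T) f g = begin
    ((f ∘ suc) ⋆ g) T ⊕ f 0 ⊗ g (suc T)      ≈⟨ +-cong (⋆-comm T (f ∘ suc) g) (*-comm (f 0) (g (suc T))) ⟩
    (g ⋆ (f ∘ suc)) T ⊕ g (suc T) ⊗ f 0      ≈⟨ +-comm _ _ ⟩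
    g (suc T) ⊗ f 0 ⊕ (g ⋆ (f ∘ suc)) T      ≈⟨ ⋆-sucʳ T g f ⟨
    (g ⋆ f) (suc T)                          ∎

  ⋆-split : ∀ i T (f g : ℕ → Carrier) →
    (f ⋆ g) (suc (T + i)) ≈ ((λ x → f (suc T + x)) ⋆ g) i ⊕ (f ⋆ (λ x → g (suc i + x))) T
  ⋆-split zero T f g = begin
    (f ⋆ g) (suc (T + 0))                         ≡⟨ ≡.cong (λ N → (f ⋆ g) (suc N)) (ℕ.+-identityʳ T) ⟩
    (f ⋆ g) (suc T)                               ≈⟨ ⋆-sucʳ T f g ⟩
    f (suc T) ⊗ g 0 ⊕ (f ⋆ (g ∘ suc)) T           ≡⟨ ≡.cong (λ N → f N ⊗ g 0 ⊕ (f ⋆ (g ∘ suc)) T) (ℕ.+-identityʳ (suc T)) ⟨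
    f (suc T + 0) ⊗ g 0 ⊕ (f ⋆ (g ∘ suc)) T       ∎
  ⋆-split (suc i) T f g = begin
      (f ⋆ g) (suc (T + suc i))
    ≡⟨ ≡.cong (λ N → (f ⋆ g) (suc N)) (ℕ.+-suc T i) ⟩
      (f ⋆ g) (suc (suc (T + i)))
    ≈⟨ ⋆-sucʳ (suc (T + i)) f g ⟩
      f (suc (suc (T + i))) ⊗ g 0 ⊕ (f ⋆ (g ∘ suc)) (suc (T + i))
    ≈⟨ +-congˡ (⋆-split i T f (g ∘ suc)) ⟩
      f (suc (suc (T + i))) ⊗ g 0 ⊕ (((λ x → f (suc T + x)) ⋆ (g ∘ suc)) i ⊕ (f ⋆ (λ x → g (suc (suc i + x)))) T)
    ≈⟨ +-assoc _ _ _ ⟨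
      f (suc (suc (T + i))) ⊗ g 0 ⊕ ((λ x → f (suc T + x)) ⋆ (g ∘ suc)) i ⊕ (f ⋆ (λ x → g (suc (suc i + x)))) T
    ≡⟨ ≡.cong (λ N → f N ⊗ g 0 ⊕ ((λ x → f (suc T + x)) ⋆ (g ∘ suc)) i ⊕ (f ⋆ (λ x → g (suc (suc i + x)))) T)
         (≡.sym (ℕ.+-suc (suc T) i)) ⟩
      f (suc T + suc i) ⊗ g 0 ⊕ ((λ x → f (suc T + x)) ⋆ (g ∘ suc)) i ⊕ (f ⋆ (λ x → g (suc (suc i + x)))) T
    ≈⟨ +-congʳ (⋆-sucʳ i (λ x → f (suc T + x)) g) ⟨
      ((λ x → f (suc T + x)) ⋆ g) (suc i) ⊕ (f ⋆ (λ x → g (suc (suc i) + x))) T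
    ∎

  ⋆-expand : ∀ i (f g : ℕ → Carrier) → (f ⋆ g) i ≈ f 0 ⊗ g i ⊕ sumBelow i (λ k → f (i ∸ k) ⊗ g k)
  ⋆-expand zero f g = sym (trans (+-congˡ (sumBelow-zero 0 λ _ ())) (+-identityʳ _))
  ⋆-expand (suc i) f g = begin
      ((f ∘ suc) ⋆ g) i ⊕ f 0 ⊗ g (suc i)
    ≈⟨ +-congʳ (⋆-expand i (f ∘ suc) g) ⟩
      f 1 ⊗ g i ⊕ sumBelow i (λ k → f (suc (i ∸ k)) ⊗ g k) ⊕ f 0 ⊗ g (suc i)
    ≈⟨ solve 3 (λ a b c → (a :+ b :+ c) := (c :+ (b :+ a))) refl (f 1 ⊗ g i) (sumBelow i (λ k → f (suc (i ∸ k)) ⊗ g k)) (f 0 ⊗ g (suc i)) ⟩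
      f 0 ⊗ g (suc i) ⊕ (sumBelow i (λ k → f (suc (i ∸ k)) ⊗ g k) ⊕ f 1 ⊗ g i)
    ≈⟨ +-congˡ (+-cong
         (sumBelow-cong i λ k k<i → *-congʳ (reflexive (≡.cong f (≡.sym (ℕ.+-∸-assoc 1 (ℕ.<⇒≤ k<i))))))
         (*-congʳ (reflexive (≡.cong f (≡.sym (ℕ.m+n∸n≡m 1 i)))))) ⟩
      f 0 ⊗ g (suc i) ⊕ (sumBelow i (λ k → f (suc i ∸ k) ⊗ g k) ⊕ f (suc i ∸ i) ⊗ g i)
    ≈⟨ +-congˡ (sumBelow-init-last i _) ⟨
      f 0 ⊗ g (suc i) ⊕ sumBelow (suc i) (λ k → f (suc i ∸ k) ⊗ g k)
    ∎

  Det-toeplitz : ∀ n (f : ℕ → Carrier) (X : Matrix) → f 0 ≈ 1# → Det n (λ i j → (f ⋆ (λ k → X k j)) i) ≈ Det n X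
  Det-toeplitz n f X f₀≈1 = Det-lower-unitriangular n (λ i k → f (i ∸ k)) λ i j →
    trans (⋆-expand i f (λ k → X k j)) (+-congʳ (trans (*-congʳ f₀≈1) (*-identityˡ _)))

  shift : ℕ → (ℕ → Carrier) → ℕ → Carrier
  shift zero g x = g x
  shift (suc d) g zero = 0#
  shift (suc d) g (suc x) = shift d g x

  shift-< : ∀ d g x → x < d → shift d g x ≡ 0#
  shift-< (suc d) g zero _ = ≡.refl
  shift-< (suc d) g (suc x) (s≤s x<d) = shift-< d g x x<d

  shift-+ : ∀ e d g x → shift (e + d) g (e + x) ≡ shift d g x
  shift-+ zero d g x = ≡.refl
  shift-+ (suc e) d g x = shift-+ e d g x

  shift-cong : ∀ d {g g′ : ℕ → Carrier} → (∀ x → g x ≈ g′ x) → ∀ x → shift d g x ≈ shift d g′ x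
  shift-cong zero g≈ x = g≈ x
  shift-cong (suc d) g≈ zero = refl
  shift-cong (suc d) g≈ (suc x) = shift-cong d g≈ x

  ⋆-shiftʳ : ∀ d T (f g : ℕ → Carrier) → (f ⋆ shift d g) T ≈ shift d (f ⋆ g) T
  ⋆-shiftʳ zero T f g = refl
  ⋆-shiftʳ (suc d) zero f g = zeroʳ (f 0)
  ⋆-shiftʳ (suc d) (suc T) f g =
    trans (⋆-sucʳ T f (shift (suc d) g)) (trans (+-cong (zeroʳ _) (⋆-shiftʳ d T f g)) (+-identityˡ _))

  shift-offset : ∀ d g x → shift d g (d + x) ≡ g x
  shift-offset zero g x = ≡.refl
  shift-offset (suc d) g x = shift-offset d g x

  shift-δ : ∀ d j → shift d (λ T → δ T 0) j ≡ δ j d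
  shift-δ zero j = ≡.refl
  shift-δ (suc d) zero = ≡.refl
  shift-δ (suc d) (suc j) = shift-δ d j

  module PathCounts (s : ℕ → Carrier) where

    Es : ℕ → Carrier
    Es k = s (suc k)

    A : ℕ → ℕ → Carrier
    A k x = aNK R Es x k

    a b : ℕ → Carrier
    a x = aNK R s x 0
    b = A 0

    aNK-suc-suc : ∀ n k → aNK R s (suc n) (suc k) ≈ (A k ⋆ a) n
    aNK-suc-suc zero zero =
      solve 1 (λ σ → (con 1 :+ σ :* con 0 :+ con 0) := (con 1 :* con 1)) refl (s 1)
    aNK-suc-suc zero (suc k) =
      solve 1 (λ σ → (con 0 :+ σ :* con 0 :+ con 0) := (con 0 :* con 1)) refl (s (2 + k))
    aNK-suc-suc (suc n) zero = begin
        a (suc n) ⊕ s 1 ⊗ aNK R s (suc n) 1 ⊕ aNK R s (suc n) 2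
      ≈⟨ +-cong (+-congˡ (*-congˡ (aNK-suc-suc n 0))) (aNK-suc-suc n 1) ⟩
        a (suc n) ⊕ s 1 ⊗ (A 0 ⋆ a) n ⊕ (A 1 ⋆ a) n
      ≈⟨ solve 4 (λ x σ P Q → (x :+ σ :* P :+ Q) := (σ :* P :+ Q :+ con 1 :* x)) refl (a (suc n)) (s 1) _ _ ⟩
        s 1 ⊗ (A 0 ⋆ a) n ⊕ (A 1 ⋆ a) n ⊕ 1# ⊗ a (suc n)
      ≈⟨ +-congʳ (trans (⋆-distribʳ-+ n _ (A 1) a) (+-congʳ (⋆-*ˡ n (s 1) (A 0) a))) ⟨
        (A 0 ⋆ a) (suc n)
      ∎
    aNK-suc-suc (suc n) (suc k) = begin
        aNK R s (suc n) (suc k) ⊕ s (2 + k) ⊗ aNK R s (suc n) (2 + k) ⊕ aNK R s (suc n) (3 + k)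
      ≈⟨ +-cong (+-cong (aNK-suc-suc n k) (*-congˡ (aNK-suc-suc n (suc k)))) (aNK-suc-suc n (2 + k)) ⟩
        (A k ⋆ a) n ⊕ s (2 + k) ⊗ (A (suc k) ⋆ a) n ⊕ (A (2 + k) ⋆ a) n
      ≈⟨ +-identityʳ _ ⟨
        (A k ⋆ a) n ⊕ s (2 + k) ⊗ (A (suc k) ⋆ a) n ⊕ (A (2 + k) ⋆ a) n ⊕ 0#
      ≈⟨ +-cong (trans (⋆-distribʳ-+ n _ (A (2 + k)) a) (+-congʳ (trans (⋆-distribʳ-+ n (A k) _ a)
                  (+-congˡ (⋆-*ˡ n (s (2 + k)) (A (suc k)) a))))) (zeroˡ (a (suc n))) ⟨
        (A (suc k) ⋆ a) (suc n)
      ∎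

    -- Coefficients of 1 − s₀z − z²B(z), the reciprocal of A(z).
    a⁻¹ : ℕ → Carrier
    a⁻¹ zero = 1#
    a⁻¹ (suc zero) = - s 0
    a⁻¹ (suc (suc x)) = - b x

    a⁻¹⋆a : ∀ T → (a⁻¹ ⋆ a) T ≈ δ T 0
    a⁻¹⋆a zero = *-identityˡ 1#
    a⁻¹⋆a (suc zero) =
      trans (+-cong (*-identityʳ _) (trans (*-identityˡ _) (trans (+-identityʳ _) (*-identityʳ _)))) (-‿inverseˡ (s 0))
    a⁻¹⋆a (suc (suc T)) = begin
        ((λ x → - b x) ⋆ a) T ⊕ - s 0 ⊗ a (suc T) ⊕ 1# ⊗ a (2 + T)
      ≈⟨ +-cong (+-cong (⋆-negˡ T b a) (sym (-‿distribˡ-* (s 0) _))) (trans (*-identityˡ _) (+-congˡ (aNK-suc-suc T 0))) ⟩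
        - (b ⋆ a) T ⊕ - (s 0 ⊗ a (suc T)) ⊕ (s 0 ⊗ a (suc T) ⊕ (b ⋆ a) T)
      ≈⟨ +-cong (-‿+-comm _ _) (+-comm _ _) ⟩
        - ((b ⋆ a) T ⊕ s 0 ⊗ a (suc T)) ⊕ ((b ⋆ a) T ⊕ s 0 ⊗ a (suc T))
      ≈⟨ -‿inverseˡ _ ⟩
        0#
      ∎

    a⁻¹⋆a-tail : ∀ T i → (a⁻¹ ⋆ (λ x → a (suc i + x))) (suc T) ≈ (a ⋆ (λ u → b (T + u))) i
    a⁻¹⋆a-tail T i = begin
        tail
      ≈⟨ x∙y⁻¹≈ε⇒x≈y tail head (begin
            tail ⊕ - head                                 ≈⟨ +-comm _ _ ⟩
            - head ⊕ tail                                 ≈⟨ +-congʳ (⋆-negˡ i (λ u → b (T + u)) a) ⟨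
            ((λ u → - b (T + u)) ⋆ a) i ⊕ tail            ≈⟨ ⋆-split i (suc T) a⁻¹ a ⟨
            (a⁻¹ ⋆ a) (suc (suc T + i))                   ≈⟨ a⁻¹⋆a (suc (suc T + i)) ⟩
            0#                                            ∎) ⟩
        head
      ≈⟨ ⋆-comm i _ a ⟩
        (a ⋆ (λ u → b (T + u))) i
      ∎
      where
        tail = (a⁻¹ ⋆ (λ x → a (suc i + x))) (suc T)
        head = ((λ u → b (T + u)) ⋆ a) i

    H : ℕ → Matrix
    H m i j = shift m a (i + j)

    aZ-⊖ : ∀ x m → aZ R s (x ℤ.⊖ m) ≈ shift m a x
    aZ-⊖ x zero = refl
    aZ-⊖ zero (suc m) = refl
    aZ-⊖ (suc x) (suc m) = trans (reflexive (≡.cong (aZ R s) ([1+m]⊖[1+n]≡m⊖n x m))) (aZ-⊖ x m)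

    aZ-shift : ∀ x m → aZ R s (+ x ℤ.+ -ℤ (+ m)) ≈ shift m a x
    aZ-shift x zero = reflexive (≡.cong a (ℕ.+-identityʳ x))
    aZ-shift x (suc m) = aZ-⊖ x (suc m)

    hankelD-negative : ∀ m n → hankelD R s (-ℤ (+ m)) n ≈ Det n (H m)
    hankelD-negative m n = trans (reflexive (hankelD≡Det s (-ℤ (+ m)) n)) (Det-cong n λ i j → aZ-shift (i + j) m)

    hankelD-negative-vanishes : ∀ m n → 0 < n → n ≤ m → hankelD R s (-ℤ (+ m)) n ≈ 0#
    hankelD-negative-vanishes m (suc n) _ n<m = trans (hankelD-negative m (suc n))
      (Det-zero-row0 n (H m) λ j j≤n → reflexive (shift-< m a j (ℕ.<-≤-trans j≤n n<m)))

    G : ℕ → Matrix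
    G m i j = (a⁻¹ ⋆ (λ x → H m x j)) i

    G-antidiagonal : ∀ m i j → i ≤ m → transpose (G m) i j ≈ δ (i + j) m
    G-antidiagonal m i j i≤m with ℕ.m≤n⇒∃[o]m+o≡n i≤m
    ... | d , ≡.refl = begin
        (a⁻¹ ⋆ (λ x → shift (i + d) a (x + i))) j
      ≈⟨ ⋆-cong j (λ _ → refl) (λ x → reflexive (≡.trans (≡.cong (shift (i + d) a) (ℕ.+-comm x i)) (shift-+ i d a x))) ⟩
        (a⁻¹ ⋆ shift d a) j
      ≈⟨ ⋆-shiftʳ d j a⁻¹ a ⟩
        shift d (a⁻¹ ⋆ a) j
      ≈⟨ shift-cong d a⁻¹⋆a j ⟩
        shift d (λ T → δ T 0) j
      ≡⟨ ≡.trans (shift-δ d j) (≡.sym (δ-+ i j d)) ⟩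
        δ (i + j) (i + d)
      ∎

    G-tail : ∀ m i j → G m (suc m + j) (suc m + i) ≈ (a ⋆ (λ u → b (u + j + m))) i
    G-tail m i j = begin
        (a⁻¹ ⋆ (λ x → shift m a (x + (suc m + i)))) (suc m + j)
      ≈⟨ ⋆-cong (suc m + j) {f = a⁻¹} {g = λ x → shift m a (x + (suc m + i))} (λ _ → refl) (λ x → reflexive (≡.trans (≡.cong (shift m a) (x+[1+m+i]≡m+[1+i+x] x m i))
                                                                      (shift-offset m a (suc i + x)))) ⟩
        (a⁻¹ ⋆ (λ x → a (suc i + x))) (suc (m + j))
      ≈⟨ a⁻¹⋆a-tail (m + j) i ⟩
        (a ⋆ (λ u → b (m + j + u))) i
      ≈⟨ ⋆-cong i (λ _ → refl) (λ u → reflexive (≡.cong b (m+j+u≡u+j+m m j u))) ⟩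
        (a ⋆ (λ u → b (u + j + m))) i
      ∎
      where
        x+[1+m+i]≡m+[1+i+x] : ∀ x m i → x + (suc m + i) ≡ m + (suc i + x)
        x+[1+m+i]≡m+[1+i+x] = solve-∀
        m+j+u≡u+j+m : ∀ m j u → m + j + u ≡ u + j + m
        m+j+u≡u+j+m = solve-∀

    hankelD-negative-shift : ∀ m n → hankelD R s (-ℤ (+ m)) (n + m + 1) ≈ sgn ((m + 1) C 2) ⊗ hankelD R Es (+ m) n
    hankelD-negative-shift m n = begin
        hankelD R s (-ℤ (+ m)) (n + m + 1)
      ≈⟨ hankelD-negative m (n + m + 1) ⟩
        Det (n + m + 1) (H m)
      ≡⟨ ≡.cong (λ N → Det N (H m)) (n+m+1≡1+m+n n m) ⟩
        Det (suc m + n) (H m)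
      ≈⟨ Det-toeplitz (suc m + n) a⁻¹ (H m) refl ⟨
        Det (suc m + n) (G m)
      ≈⟨ Det-transpose (suc m + n) (G m) ⟨
        Det (suc m + n) (transpose (G m))
      ≈⟨ Det-peel-antidiagonal m n (transpose (G m)) (G-antidiagonal m) ⟩
        sgn (suc m C 2) ⊗ Det n (λ i j → G m (suc m + j) (suc m + i))
      ≈⟨ *-congˡ (Det-cong n (G-tail m)) ⟩
        sgn (suc m C 2) ⊗ Det n (λ i j → (a ⋆ (λ u → b (u + j + m))) i)
      ≈⟨ *-congˡ (Det-toeplitz n a (λ u j → b (u + j + m)) refl) ⟩
        sgn (suc m C 2) ⊗ Det n (λ u j → b (u + j + m))
      ≡⟨ ≡.cong₂ (λ k D → sgn (k C 2) ⊗ D) (ℕ.+-comm 1 m) (≡.sym (hankelD≡Det Es (+ m) n)) ⟩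
        sgn ((m + 1) C 2) ⊗ hankelD R Es (+ m) n
      ∎
      where
        n+m+1≡1+m+n : ∀ n m → n + m + 1 ≡ suc m + n
        n+m+1≡1+m+n = solve-∀

theorem1 : ∀ {c ℓ} (R : CommutativeRing c ℓ) (s : ℕ → CommutativeRing.Carrier R) (m : ℕ) → 0 < m →
    ((n : ℕ) → 0 < n → n ≤ m →
    CommutativeRing._≈_ R (hankelD R s (-ℤ (+ m)) n) (CommutativeRing.0# R))
    × ((n : ℕ) →
    CommutativeRing._≈_ R (hankelD R s (-ℤ (+ m)) (n + m + 1))
    (CommutativeRing._*_ R (negOnePow R ((m + 1) C 2)) (hankelD R (λ k → s (suc k)) (+ m) n)))
theorem1 R s m _ = hankelD-negative-vanishes m , hankelD-negative-shift m
  where open HankelDeterminants.PathCounts R s
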